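{- Let $G$ be an undirected graph (possibly with multiple edges), $w:V(G)\to\mathbb{Q}$ a weight function, $k$ a positive integer and $R\subseteq V(G)$ a set such that $F=G\setminus R$ is a forest. Let $x\in V(F)$ be a leaf of $F$ whose only neighbour in $F$ is $y$, and suppose $x$ has at most $2$ neighbours in $R$. Let $G^*$ be obtained from $G$ by subdividing the edge $(x,y)$ with a new vertex $x^*$, and let $w^*:V(G)\cup\{x^*\}\to\mathbb{Q}$ be given by $w^*(x^*)=1$ and $w^*(v)=w(v)$ for $v\in V(G)$. Then for every number $W$, there is a set $S\subseteq V(G)\setminus R$ with $|S|\le k$, $w(S)\le W$ and $G\setminus S$ a forest if and only if there is a set $S'\subseteq V(G^*)\setminus (R\cup\{x^*\})$ with $|S'|\le k$, $w^*(S')\le W$ and $G^*\setminus S'$ a forest.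
   Context: For $X\subseteq V(G)$, $w(X)=\sum_{v\in X}w(v)$. Subdividing an edge $(x,y)$ means replacing it by a new vertex $x^*$ and the two edges $(x,x^*)$, $(x^*,y)$. A leaf of a forest is a vertex of degree one in it. -}

module Defs where

open import Data.Nat using (ℕ; zero; suc; _<_)
open import Data.Nat.DivMod using (_%_; m%n<n)
open import Data.Fin using (Fin; zero; suc; toℕ; fromℕ<)
open import Data.Fin.Subset using (Subset; _∈_; _∉_)
open import Data.Vec using ([]; _∷_)
open import Data.Bool using (true; false)
open import Data.List using (List; []; _∷_; length; lookup; map; removeAt)
open import Data.Product using (_×_; _,_; ∃; Σ)
open import Data.Sum using (_⊎_)
open import Data.Rational using (ℚ; 0ℚ; 1ℚ; _+_)
open import Relation.Binary.PropositionalEquality using (_≡_; _≢_)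
open import Function.Definitions using (Injective)

-- A multigraph on vertex set Fin n is a list of edges (pairs of endpoints);
-- parallel edges and loops are allowed (both are cycles).
Edges : ℕ → Set
Edges n = List (Fin n × Fin n)

Joins : ∀ {n} → Fin n × Fin n → Fin n → Fin n → Set
Joins e a b = (e ≡ (a , b)) ⊎ (e ≡ (b , a))

Adjacent : ∀ {n} → Edges n → Fin n → Fin n → Set
Adjacent E a b = ∃ λ (j : Fin (length E)) → Joins (lookup E j) a b

next : ∀ {m} → Fin (suc m) → Fin (suc m)
next {m} i = fromℕ< (m%n<n (suc (toℕ i)) (suc m))

record Cycle {n} (E : Edges n) (S : Subset n) (m : ℕ) : Set where
  field
    vtx       : Fin (suc m) → Fin n
    edg       : Fin (suc m) → Fin (length E)
    vtx-inj   : Injective _≡_ _≡_ vtx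
    edg-inj   : Injective _≡_ _≡_ edg
    vtx-out   : ∀ i → vtx i ∉ S
    edg-joins : ∀ i → Joins (lookup E (edg i)) (vtx i) (vtx (next i))

IsForestWithout : ∀ {n} → Edges n → Subset n → Set
IsForestWithout E S = ∀ m → Cycle E S m → ⊥
  where open import Data.Empty using (⊥)

wsum : ∀ {n} → (Fin n → ℚ) → Subset n → ℚ
wsum {zero}  w []          = 0ℚ
wsum {suc n} w (true ∷ S)  = w zero + wsum (λ i → w (suc i)) S
wsum {suc n} w (false ∷ S) = wsum (λ i → w (suc i)) S

-- G* : vertex set Fin (suc n); new vertex x* = zero, old vertex v ↦ suc v.
liftEdge : ∀ {n} → Fin n × Fin n → Fin (suc n) × Fin (suc n)
liftEdge (a , b) = suc a , suc b

subdivide : ∀ {n} (E : Edges n) → Fin (length E) → Fin n → Fin n → Edges (suc n)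
subdivide E ex x y = (suc x , zero) ∷ (zero , suc y) ∷ map liftEdge (removeAt E ex)

wstar : ∀ {n} → (Fin n → ℚ) → Fin (suc n) → ℚ
wstar w zero    = 1ℚ
wstar w (suc v) = w v

-- Subdividing the edge xy does not change which vertex sets leave a forest.  A cycle of
-- G* \ S either avoids x*, and then it is a cycle of G \ S avoiding xy, or it runs
-- x, x*, y, and then shortcutting it through xy gives a cycle of G \ S; conversely a cycle
-- of G \ S through xy is lengthened through x*.  As x* may not be deleted, S ↦ S is a
-- bijection between the feasible sets of the two instances preserving size and weight.
module Submission where

open import Defs
open import Data.Nat using (ℕ; zero; suc; _≤_; _<_; s≤s)
open import Data.Nat.Properties using (<⇒≤)
open import Data.Nat.DivMod using (_%_; n%n≡0; m<n⇒m%n≡m)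
open import Data.Fin using (Fin; zero; suc; toℕ; fromℕ; inject₁; cast; _≟_)
open import Data.Fin.Properties
  using ( toℕ-injective; toℕ-fromℕ<; toℕ-fromℕ; toℕ-inject₁; toℕ<n; suc-injective; 0≢1+n
        ; inject₁-injective; fromℕ≢inject₁; cast-involutive; any?)
open import Data.Fin.Subset using (Subset; _∈_; _∉_; ∣_∣)
open import Data.Vec.Base using (_∷_; here; there)
open import Data.Bool using (true; false)
open import Data.List using (_∷_; length; lookup; map; removeAt)
open import Data.List.Properties using (length-map)
open import Data.Product using (_×_; _,_; ∃; ∃₂; Σ; proj₁; proj₂)
open import Data.Sum using (_⊎_; inj₁; inj₂)
open import Data.Empty using (⊥-elim)
open import Data.Rational using (ℚ) renaming (_≤_ to _≤ℚ_)
open import Relation.Nullary using (¬_; yes; no)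
open import Relation.Binary.PropositionalEquality
open import Function.Base using (_∘_; id)
open import Function.Bundles using (_⇔_; mk⇔; Equivalence)
open import Function.Definitions using (Injective)

open Cycle
open ≡-Reasoning

private variable
  n m : ℕ
  A : Set

data InitOrLast : ∀ {m} → Fin (suc m) → Set where
  init : (t : Fin m) → InitOrLast (inject₁ t)
  last : InitOrLast (fromℕ m)

initOrLast : (i : Fin (suc m)) → InitOrLast i
initOrLast {zero}  zero    = last
initOrLast {suc m} zero    = init zero
initOrLast {suc m} (suc i) with initOrLast i
... | init t = init (suc t)
... | last   = last

toℕ-next : (i : Fin (suc m)) → toℕ (next i) ≡ suc (toℕ i) % suc m
toℕ-next i = toℕ-fromℕ< _

next-fromℕ : ∀ m → next (fromℕ m) ≡ zero
next-fromℕ m = toℕ-injective (begin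
  toℕ (next (fromℕ m))         ≡⟨ toℕ-next (fromℕ m) ⟩
  suc (toℕ (fromℕ m)) % suc m  ≡⟨ cong (λ k → suc k % suc m) (toℕ-fromℕ m) ⟩
  suc m % suc m                ≡⟨ n%n≡0 (suc m) ⟩
  0                            ∎)

next-inject₁ : (t : Fin m) → next (inject₁ t) ≡ suc t
next-inject₁ {m} t = toℕ-injective (begin
  toℕ (next (inject₁ t))         ≡⟨ toℕ-next (inject₁ t) ⟩
  suc (toℕ (inject₁ t)) % suc m  ≡⟨ cong (λ k → suc k % suc m) (toℕ-inject₁ t) ⟩
  suc (toℕ t) % suc m            ≡⟨ m<n⇒m%n≡m (s≤s (toℕ<n t)) ⟩
  suc (toℕ t)                    ∎)

next-injective : Injective _≡_ _≡_ (next {m})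
next-injective {m} {i} {j} eq with initOrLast i | initOrLast j
... | init s | init t = cong inject₁ (suc-injective (begin
  suc s             ≡⟨ next-inject₁ s ⟨
  next (inject₁ s)  ≡⟨ eq ⟩
  next (inject₁ t)  ≡⟨ next-inject₁ t ⟩
  suc t             ∎))
... | init s | last   = ⊥-elim (0≢1+n (trans (sym (trans eq (next-fromℕ _))) (next-inject₁ s)))
... | last   | init t = ⊥-elim (0≢1+n (trans (sym (trans (sym eq) (next-fromℕ _))) (next-inject₁ t)))
... | last   | last   = refl

next^ : ℕ → Fin (suc m) → Fin (suc m)
next^ zero    = id
next^ (suc s) = next ∘ next^ s

next^-next : ∀ s (i : Fin (suc m)) → next^ s (next i) ≡ next (next^ s i)
next^-next zero    i = refl
next^-next (suc s) i = cong next (next^-next s i)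

next^-injective : ∀ s → Injective _≡_ _≡_ (next^ {m} s)
next^-injective zero    eq = eq
next^-injective (suc s) eq = next^-injective s (next-injective eq)

toℕ-next^-zero : ∀ k → k < suc m → toℕ (next^ k (zero {m})) ≡ k
toℕ-next^-zero zero    _      = refl
toℕ-next^-zero {m} (suc k) 1+k<1+m = begin
  toℕ (next (next^ k zero))          ≡⟨ toℕ-next (next^ k zero) ⟩
  suc (toℕ (next^ k zero)) % suc m  ≡⟨ cong (λ l → suc l % suc m) (toℕ-next^-zero k (<⇒≤ 1+k<1+m)) ⟩
  suc k % suc m                     ≡⟨ m<n⇒m%n≡m 1+k<1+m ⟩
  suc k                             ∎

next^-fromℕ : (p : Fin (suc m)) → next^ (suc (toℕ p)) (fromℕ m) ≡ p
next^-fromℕ {m} p = begin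
  next (next^ (toℕ p) (fromℕ m))  ≡⟨ next^-next (toℕ p) (fromℕ m) ⟨
  next^ (toℕ p) (next (fromℕ m))  ≡⟨ cong (next^ (toℕ p)) (next-fromℕ m) ⟩
  next^ (toℕ p) zero              ≡⟨ toℕ-injective (toℕ-next^-zero (toℕ p) (toℕ<n p)) ⟩
  p                               ∎

infixl 5 _∷ʳ_
_∷ʳ_ : (Fin m → A) → A → Fin (suc m) → A
_∷ʳ_ {zero}  f a zero    = a
_∷ʳ_ {suc m} f a zero    = f zero
_∷ʳ_ {suc m} f a (suc i) = (f ∘ suc ∷ʳ a) i

∷ʳ-inject₁ : (f : Fin m → A) (a : A) (t : Fin m) → (f ∷ʳ a) (inject₁ t) ≡ f t
∷ʳ-inject₁ f a zero    = refl
∷ʳ-inject₁ f a (suc t) = ∷ʳ-inject₁ (f ∘ suc) a t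

∷ʳ-fromℕ : (f : Fin m → A) (a : A) → (f ∷ʳ a) (fromℕ m) ≡ a
∷ʳ-fromℕ {zero}  f a = refl
∷ʳ-fromℕ {suc m} f a = ∷ʳ-fromℕ (f ∘ suc) a

∷ʳ-all : {P : A → Set} {f : Fin m → A} {a : A} →
         (∀ t → P (f t)) → P a → ∀ i → P ((f ∷ʳ a) i)
∷ʳ-all {P = P} {f} {a} Pf Pa i with initOrLast i
... | init t = subst P (sym (∷ʳ-inject₁ f a t)) (Pf t)
... | last   = subst P (sym (∷ʳ-fromℕ f a)) Pa

∷ʳ-injective : {f : Fin m → A} {a : A} →
               Injective _≡_ _≡_ f → (∀ t → f t ≢ a) → Injective _≡_ _≡_ (f ∷ʳ a)
∷ʳ-injective {f = f} {a} f-inj f≢a {i} {j} eq with initOrLast i | initOrLast j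
... | init s | init t = cong inject₁ (f-inj (begin
  f s                    ≡⟨ ∷ʳ-inject₁ f a s ⟨
  (f ∷ʳ a) (inject₁ s)   ≡⟨ eq ⟩
  (f ∷ʳ a) (inject₁ t)   ≡⟨ ∷ʳ-inject₁ f a t ⟩
  f t                    ∎))
... | init s | last   = ⊥-elim (f≢a s (trans (sym (∷ʳ-inject₁ f a s)) (trans eq (∷ʳ-fromℕ f a))))
... | last   | init t = ⊥-elim (f≢a t (trans (sym (∷ʳ-inject₁ f a t)) (trans (sym eq) (∷ʳ-fromℕ f a))))
... | last   | last   = refl

module _ {A B : Set} (h : A → B) where

  lookup-map : ∀ xs (k : Fin (length (map h xs))) →
               lookup (map h xs) k ≡ h (lookup xs (cast (length-map h xs) k))
  lookup-map (x ∷ xs) zero    = refl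
  lookup-map (x ∷ xs) (suc k) = lookup-map xs k

  originOf : ∀ xs (i : Fin (length xs)) → Fin (length (map h (removeAt xs i))) → Fin (length xs)
  originOf (_ ∷ xs) zero    k       = suc (cast (length-map h xs) k)
  originOf (_ ∷ _)  (suc i) zero    = zero
  originOf (_ ∷ xs) (suc i) (suc k) = suc (originOf xs i k)

  lookup-originOf : ∀ xs i (k : Fin (length (map h (removeAt xs i)))) →
                    lookup (map h (removeAt xs i)) k ≡ h (lookup xs (originOf xs i k))
  lookup-originOf (_ ∷ xs) zero    k       = lookup-map xs k
  lookup-originOf (_ ∷ _)  (suc i) zero    = refl
  lookup-originOf (_ ∷ xs) (suc i) (suc k) = lookup-originOf xs i k

  originOf-injective : ∀ xs i {k l} → originOf xs i k ≡ originOf xs i l → k ≡ l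
  originOf-injective (_ ∷ xs) zero {k} {l} eq = begin
    k                              ≡⟨ cast-involutive (sym lenₕ) lenₕ k ⟨
    cast (sym lenₕ) (cast lenₕ k)  ≡⟨ cong (cast (sym lenₕ)) (suc-injective eq) ⟩
    cast (sym lenₕ) (cast lenₕ l)  ≡⟨ cast-involutive (sym lenₕ) lenₕ l ⟩
    l                              ∎
    where lenₕ = length-map h xs
  originOf-injective (_ ∷ _)  (suc i) {zero}  {zero}  eq = refl
  originOf-injective (_ ∷ xs) (suc i) {suc k} {suc l} eq =
    cong suc (originOf-injective xs i (suc-injective eq))

  originOf≢ : ∀ xs i k → originOf xs i k ≢ i
  originOf≢ (_ ∷ xs) (suc i) (suc k) eq = originOf≢ xs i k (suc-injective eq)

  originOf-surjective : ∀ xs i {j} → j ≢ i → ∃ λ k → originOf xs i k ≡ j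
  originOf-surjective (_ ∷ xs) zero    {zero}  j≢i = ⊥-elim (j≢i refl)
  originOf-surjective (_ ∷ xs) zero    {suc j} _   =
    cast (sym lenₕ) j , cong suc (cast-involutive lenₕ (sym lenₕ) j)
    where lenₕ = length-map h xs
  originOf-surjective (_ ∷ _)  (suc i) {zero}  _   = zero , refl
  originOf-surjective (_ ∷ xs) (suc i) {suc j} j≢i
    with k , eq ← originOf-surjective xs i (j≢i ∘ cong suc) = suc k , cong suc eq

module _ {n} {e : Fin n × Fin n} where

  Joins-sym : ∀ {a b} → Joins e a b → Joins e b a
  Joins-sym (inj₁ eq) = inj₂ eq
  Joins-sym (inj₂ eq) = inj₁ eq

  Joins-resp : ∀ {e′ a a′ b b′} → e ≡ e′ → a ≡ a′ → b ≡ b′ → Joins e a b → Joins e′ a′ b′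
  Joins-resp refl refl refl J = J

  Joins-endpoints : ∀ {a b c d} → Joins e a b → Joins e c d → (a ≡ c × b ≡ d) ⊎ (a ≡ d × b ≡ c)
  Joins-endpoints (inj₁ refl) (inj₁ refl) = inj₁ (refl , refl)
  Joins-endpoints (inj₁ refl) (inj₂ refl) = inj₂ (refl , refl)
  Joins-endpoints (inj₂ refl) (inj₁ refl) = inj₂ (refl , refl)
  Joins-endpoints (inj₂ refl) (inj₂ refl) = inj₁ (refl , refl)

module _ {n} {e : Fin n × Fin n} {a b : Fin n} where

  Joins-liftEdge : Joins e a b → Joins (liftEdge e) (suc a) (suc b)
  Joins-liftEdge (inj₁ refl) = inj₁ refl
  Joins-liftEdge (inj₂ refl) = inj₂ refl

  Joins-liftEdge⁻ : Joins (liftEdge e) (suc a) (suc b) → Joins e a b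
  Joins-liftEdge⁻ (inj₁ refl) = inj₁ refl
  Joins-liftEdge⁻ (inj₂ refl) = inj₂ refl

liftEdge-¬Joins-zero : ∀ {n} {e : Fin n × Fin n} {u} → ¬ Joins (liftEdge e) u zero
liftEdge-¬Joins-zero {e = _ , _} (inj₁ ())
liftEdge-¬Joins-zero {e = _ , _} (inj₂ ())

rotate : ∀ {E : Edges n} {S} → Cycle E S m → ℕ → Cycle E S m
rotate {E = E} C s = record
  { vtx       = vtx C ∘ next^ s
  ; edg       = edg C ∘ next^ s
  ; vtx-inj   = next^-injective s ∘ vtx-inj C
  ; edg-inj   = next^-injective s ∘ edg-inj C
  ; vtx-out   = vtx-out C ∘ next^ s
  ; edg-joins = λ i → subst (Joins (lookup E (edg C (next^ s i))) (vtx C (next^ s i)) ∘ vtx C)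
                             (sym (next^-next s i)) (edg-joins C (next^ s i))
  }

module Subdivision {n} (E : Edges n) (ex : Fin (length E)) {x y : Fin n}
                   (xy∈E : Joins (lookup E ex) x y) where

  E* : Edges (suc n)
  E* = subdivide E ex x y

  collapse : Fin (suc n) → Fin n
  collapse zero    = x
  collapse (suc v) = v

  collapse-injective : ∀ {u v} → u ≢ zero → v ≢ zero → collapse u ≡ collapse v → u ≡ v
  collapse-injective {zero}  u≢0 _   _  = ⊥-elim (u≢0 refl)
  collapse-injective {suc _} {zero} _ v≢0 _ = ⊥-elim (v≢0 refl)
  collapse-injective {suc _} {suc _} _ _ eq = cong suc eq

  collapse-∉ : ∀ {S u} → u ≢ zero → u ∉ false ∷ S → collapse u ∉ S
  collapse-∉ {u = zero}  u≢0 _   = ⊥-elim (u≢0 refl)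
  collapse-∉ {u = suc _} _   u∉S v∈S = u∉S (there v∈S)

  lower : Fin (length (map liftEdge (removeAt E ex))) → Fin (length E)
  lower = originOf liftEdge E ex

  lookup-E*-lifted : ∀ k → lookup E* (suc (suc k)) ≡ liftEdge (lookup E (lower k))
  lookup-E*-lifted = lookup-originOf liftEdge E ex

  Lifted : Fin (length E*) → Fin n → Fin n → Set
  Lifted j a b = ∃ λ k → j ≡ suc (suc k) × Joins (lookup E (lower k)) a b

  Lifted-injective : ∀ {j j′ a b c d} (l : Lifted j a b) (l′ : Lifted j′ c d) →
                     lower (proj₁ l) ≡ lower (proj₁ l′) → j ≡ j′
  Lifted-injective (_ , refl , _) (_ , refl , _) eq =
    cong (λ k → suc (suc k)) (originOf-injective liftEdge E ex eq)

  joins-x* : ∀ {j u} → Joins (lookup E* j) u zero →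
             (j ≡ zero × u ≡ suc x) ⊎ (j ≡ suc zero × u ≡ suc y)
  joins-x* {zero}          (inj₁ refl) = inj₁ (refl , refl)
  joins-x* {suc zero}      (inj₂ refl) = inj₂ (refl , refl)
  joins-x* {suc (suc k)} J =
    ⊥-elim (liftEdge-¬Joins-zero (subst (λ e → Joins e _ zero) (lookup-E*-lifted k) J))

  ¬loop-x* : ∀ {j} → ¬ Joins (lookup E* j) zero zero
  ¬loop-x* {j} J with joins-x* {j} J
  ... | inj₁ (_ , ())
  ... | inj₂ (_ , ())

  joins-through-x* : ∀ {j j′ u v} → j ≢ j′ → Joins (lookup E* j) u zero → Joins (lookup E* j′) v zero →
                     Joins (lookup E ex) (collapse u) (collapse v)
  joins-through-x* {j} {j′} j≢j′ J J′ with joins-x* {j} J | joins-x* {j′} J′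
  ... | inj₁ (refl , refl) | inj₁ (refl , refl) = ⊥-elim (j≢j′ refl)
  ... | inj₁ (refl , refl) | inj₂ (refl , refl) = xy∈E
  ... | inj₂ (refl , refl) | inj₁ (refl , refl) = Joins-sym xy∈E
  ... | inj₂ (refl , refl) | inj₂ (refl , refl) = ⊥-elim (j≢j′ refl)

  joins-lower : ∀ {j u v} → u ≢ zero → v ≢ zero → Joins (lookup E* j) u v →
                Lifted j (collapse u) (collapse v)
  joins-lower {u = zero}  u≢0 _ _ = ⊥-elim (u≢0 refl)
  joins-lower {u = suc _} {zero} _ v≢0 _ = ⊥-elim (v≢0 refl)
  joins-lower {zero}        {suc _} {suc _} _ _ (inj₁ ())
  joins-lower {zero}        {suc _} {suc _} _ _ (inj₂ ())
  joins-lower {suc zero}    {suc _} {suc _} _ _ (inj₁ ())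
  joins-lower {suc zero}    {suc _} {suc _} _ _ (inj₂ ())
  joins-lower {suc (suc k)} {suc _} {suc _} _ _ J =
    k , refl , Joins-liftEdge⁻ (subst (λ e → Joins e _ _) (lookup-E*-lifted k) J)

  x*-edges : ∀ {a b} → Joins (lookup E ex) a b →
             ∃₂ λ j j′ → j ≢ j′ × Joins (lookup E* j) (suc a) zero × Joins (lookup E* j′) zero (suc b)
  x*-edges J with Joins-endpoints J xy∈E
  ... | inj₁ (refl , refl) = zero , suc zero , (λ ()) , inj₁ refl , inj₁ refl
  ... | inj₂ (refl , refl) = suc zero , zero , (λ ()) , inj₂ refl , inj₂ refl

  raise : (j : Fin (length E)) → j ≢ ex → Fin (length E*)
  raise j j≢ex = suc (suc (proj₁ (originOf-surjective liftEdge E ex j≢ex)))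

  lookup-raise : ∀ {j} (j≢ex : j ≢ ex) → lookup E* (raise j j≢ex) ≡ liftEdge (lookup E j)
  lookup-raise j≢ex with k , refl ← originOf-surjective liftEdge E ex j≢ex = lookup-E*-lifted k

  raise-injective : ∀ {i j} (i≢ex : i ≢ ex) (j≢ex : j ≢ ex) → raise i i≢ex ≡ raise j j≢ex → i ≡ j
  raise-injective i≢ex j≢ex eq
    with k , refl ← originOf-surjective liftEdge E ex i≢ex
       | l , refl ← originOf-surjective liftEdge E ex j≢ex
       = cong lower (suc-injective (suc-injective eq))

  raise-joins : ∀ {j a b} (j≢ex : j ≢ ex) → Joins (lookup E j) a b →
                Joins (lookup E* (raise j j≢ex)) (suc a) (suc b)
  raise-joins j≢ex J = subst (λ e → Joins e _ _) (sym (lookup-raise j≢ex)) (Joins-liftEdge J)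

  raise≢x*-edge : ∀ {j j′ u} (j≢ex : j ≢ ex) → Joins (lookup E* j′) u zero → raise j j≢ex ≢ j′
  raise≢x*-edge j≢ex J refl =
    liftEdge-¬Joins-zero (subst (λ e → Joins e _ zero) (lookup-raise j≢ex) J)

  contract-avoiding : ∀ {S m} (C : Cycle E* (false ∷ S) m) → (∀ i → vtx C i ≢ zero) → Cycle E S m
  contract-avoiding C avoids = record
    { vtx       = collapse ∘ vtx C
    ; edg       = lower ∘ proj₁ ∘ lifted
    ; vtx-inj   = λ {i} {j} → vtx-inj C ∘ collapse-injective (avoids i) (avoids j)
    ; edg-inj   = λ {i} {j} → edg-inj C ∘ Lifted-injective (lifted i) (lifted j)
    ; vtx-out   = λ i → collapse-∉ (avoids i) (vtx-out C i)
    ; edg-joins = proj₂ ∘ proj₂ ∘ lifted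
    }
    where
      lifted : ∀ i → Lifted (edg C i) (collapse (vtx C i)) (collapse (vtx C (next i)))
      lifted i = joins-lower (avoids i) (avoids (next i)) (edg-joins C i)

  contract-through : ∀ {S m} (C : Cycle E* (false ∷ S) (suc m)) → vtx C (fromℕ (suc m)) ≡ zero →
                     Cycle E S m
  contract-through {S} {m} C x*-last = record
    { vtx       = vtx′
    ; edg       = edg′
    ; vtx-inj   = λ {i} {j} → inject₁-injective ∘ vtx-inj C ∘ collapse-injective (avoids i) (avoids j)
    ; edg-inj   = ∷ʳ-injective
                    (λ {s} {t} → inject₁-injective ∘ inject₁-injective ∘ edg-inj C
                                 ∘ Lifted-injective (lifted s) (lifted t))
                    (λ t → originOf≢ liftEdge E ex (proj₁ (lifted t)))
    ; vtx-out   = λ i → collapse-∉ (avoids i) (vtx-out C (inject₁ i))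
    ; edg-joins = joins
    }
    where
      vtx′ : Fin (suc m) → Fin n
      vtx′ = collapse ∘ vtx C ∘ inject₁

      avoids : ∀ i → vtx C (inject₁ i) ≢ zero
      avoids i eq = fromℕ≢inject₁ (vtx-inj C (trans x*-last (sym eq)))

      lifted : ∀ t → Lifted (edg C (inject₁ (inject₁ t))) (vtx′ (inject₁ t)) (vtx′ (suc t))
      lifted t = joins-lower (avoids (inject₁ t)) (avoids (suc t))
        (Joins-resp refl refl (cong (vtx C) (next-inject₁ (inject₁ t)))
                    (edg-joins C (inject₁ (inject₁ t))))

      inner : Fin m → Fin (length E)
      inner = lower ∘ proj₁ ∘ lifted

      edg′ : Fin (suc m) → Fin (length E)
      edg′ = inner ∷ʳ ex

      into-x* : Joins (lookup E* (edg C (inject₁ (fromℕ m)))) (vtx C (inject₁ (fromℕ m))) zero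
      into-x* = subst (Joins _ _) (trans (cong (vtx C) (next-inject₁ (fromℕ m))) x*-last)
                      (edg-joins C (inject₁ (fromℕ m)))

      out-of-x* : Joins (lookup E* (edg C (fromℕ (suc m)))) (vtx C zero) zero
      out-of-x* = Joins-sym (Joins-resp refl x*-last (cong (vtx C) (next-fromℕ (suc m)))
                                        (edg-joins C (fromℕ (suc m))))

      joins : ∀ i → Joins (lookup E (edg′ i)) (vtx′ i) (vtx′ (next i))
      joins i with initOrLast i
      ... | init t = Joins-resp (cong (lookup E) (sym (∷ʳ-inject₁ inner ex t))) refl
                       (cong vtx′ (sym (next-inject₁ t))) (proj₂ (proj₂ (lifted t)))
      ... | last   = Joins-resp (cong (lookup E) (sym (∷ʳ-fromℕ inner ex))) refl
                       (cong vtx′ (sym (next-fromℕ m)))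
                       (joins-through-x* {edg C (inject₁ (fromℕ m))}
                          (λ eq → fromℕ≢inject₁ (sym (edg-inj C eq))) into-x* out-of-x*)

  expand-avoiding : ∀ {S m} (C : Cycle E S m) → (∀ i → edg C i ≢ ex) → Cycle E* (false ∷ S) m
  expand-avoiding C avoids = record
    { vtx       = suc ∘ vtx C
    ; edg       = λ i → raise (edg C i) (avoids i)
    ; vtx-inj   = vtx-inj C ∘ suc-injective
    ; edg-inj   = λ {i} {j} → edg-inj C ∘ raise-injective (avoids i) (avoids j)
    ; vtx-out   = λ { i (there v∈S) → vtx-out C i v∈S }
    ; edg-joins = λ i → raise-joins (avoids i) (edg-joins C i)
    }

  expand-through : ∀ {S m} (C : Cycle E S m) → edg C (fromℕ m) ≡ ex → Cycle E* (false ∷ S) (suc m)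
  expand-through {S} {m} C ex-last = insert-x* (x*-edges ex-joins)
    where
      ex-joins : Joins (lookup E ex) (vtx C (fromℕ m)) (vtx C zero)
      ex-joins = Joins-resp (cong (lookup E) ex-last) refl (cong (vtx C) (next-fromℕ m))
                            (edg-joins C (fromℕ m))

      inner≢ex : ∀ t → edg C (inject₁ t) ≢ ex
      inner≢ex t eq = fromℕ≢inject₁ (edg-inj C (trans ex-last (sym eq)))

      inner : Fin m → Fin (length E*)
      inner t = raise (edg C (inject₁ t)) (inner≢ex t)

      vtx′ : Fin (suc (suc m)) → Fin (suc n)
      vtx′ = suc ∘ vtx C ∷ʳ zero

      insert-x* : ∃₂ (λ j j′ → j ≢ j′ × Joins (lookup E* j) (suc (vtx C (fromℕ m))) zero
                                      × Joins (lookup E* j′) zero (suc (vtx C zero))) →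
                  Cycle E* (false ∷ S) (suc m)
      insert-x* (j , j′ , j≢j′ , into-x* , out-of-x*) = record
        { vtx       = vtx′
        ; edg       = edg′
        ; vtx-inj   = ∷ʳ-injective (vtx-inj C ∘ suc-injective) (λ _ ())
        ; edg-inj   = ∷ʳ-injective
                        (∷ʳ-injective (λ {s} {t} → inject₁-injective ∘ edg-inj C
                                                   ∘ raise-injective (inner≢ex s) (inner≢ex t))
                                      (λ t → raise≢x*-edge (inner≢ex t) into-x*))
                        (∷ʳ-all {P = _≢ j′} (λ t → raise≢x*-edge (inner≢ex t) (Joins-sym out-of-x*)) j≢j′)
        ; vtx-out   = ∷ʳ-all {P = _∉ false ∷ S} (λ { t (there v∈S) → vtx-out C t v∈S }) (λ ())
        ; edg-joins = joins
        }
        where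
          edg′ : Fin (suc (suc m)) → Fin (length E*)
          edg′ = inner ∷ʳ j ∷ʳ j′

          edg′-inner : ∀ s → edg′ (inject₁ (inject₁ s)) ≡ inner s
          edg′-inner s = trans (∷ʳ-inject₁ (inner ∷ʳ j) j′ (inject₁ s)) (∷ʳ-inject₁ inner j s)

          edg′-into-x* : edg′ (inject₁ (fromℕ m)) ≡ j
          edg′-into-x* = trans (∷ʳ-inject₁ (inner ∷ʳ j) j′ (fromℕ m)) (∷ʳ-fromℕ inner j)

          edg′-out-of-x* : edg′ (fromℕ (suc m)) ≡ j′
          edg′-out-of-x* = ∷ʳ-fromℕ (inner ∷ʳ j) j′

          vtx′-old : ∀ t → vtx′ (inject₁ t) ≡ suc (vtx C t)
          vtx′-old = ∷ʳ-inject₁ (suc ∘ vtx C) zero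

          vtx′-x* : vtx′ (fromℕ (suc m)) ≡ zero
          vtx′-x* = ∷ʳ-fromℕ (suc ∘ vtx C) zero

          joins : ∀ i → Joins (lookup E* (edg′ i)) (vtx′ i) (vtx′ (next i))
          joins i with initOrLast i
          ... | last = Joins-resp (cong (lookup E*) (sym edg′-out-of-x*)) (sym vtx′-x*)
                         (cong vtx′ (sym (next-fromℕ (suc m)))) out-of-x*
          ... | init t with initOrLast t
          ...   | last = Joins-resp (cong (lookup E*) (sym edg′-into-x*)) (sym (vtx′-old (fromℕ m)))
                           (trans (sym vtx′-x*) (cong vtx′ (sym (next-inject₁ (fromℕ m)))))
                           into-x*
          ...   | init s = Joins-resp (cong (lookup E*) (sym (edg′-inner s))) (sym (vtx′-old (inject₁ s)))
                           (begin
                             suc (vtx C (next (inject₁ s)))  ≡⟨ cong (suc ∘ vtx C) (next-inject₁ s) ⟩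
                             suc (vtx C (suc s))             ≡⟨ vtx′-old (suc s) ⟨
                             vtx′ (suc (inject₁ s))          ≡⟨ cong vtx′ (next-inject₁ (inject₁ s)) ⟨
                             vtx′ (next (inject₁ (inject₁ s))) ∎)
                           (raise-joins (inner≢ex s) (edg-joins C (inject₁ s)))

  contract-last : ∀ {S m} (C : Cycle E* (false ∷ S) m) → vtx C (fromℕ m) ≡ zero → ∃ (Cycle E S)
  contract-last {m = zero}  C x*-last = ⊥-elim (¬loop-x* {edg C zero} (Joins-resp refl x*-last
    (trans (cong (vtx C) (next-fromℕ 0)) x*-last) (edg-joins C zero)))
  contract-last {m = suc m} C x*-last = m , contract-through C x*-last

  contract : ∀ {S m} → Cycle E* (false ∷ S) m → ∃ (Cycle E S)
  contract {m = m} C with any? (λ i → vtx C i ≟ zero)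
  ... | no ¬through = m , contract-avoiding C (λ i eq → ¬through (i , eq))
  ... | yes (p , x*-at-p) =
    contract-last (rotate C (suc (toℕ p))) (trans (cong (vtx C) (next^-fromℕ p)) x*-at-p)

  expand : ∀ {S m} → Cycle E S m → ∃ (Cycle E* (false ∷ S))
  expand {m = m} C with any? (λ i → edg C i ≟ ex)
  ... | no ¬through = m , expand-avoiding C (λ i eq → ¬through (i , eq))
  ... | yes (p , ex-at-p) =
    suc m , expand-through (rotate C (suc (toℕ p))) (trans (cong (edg C) (next^-fromℕ p)) ex-at-p)

  forest⇔ : ∀ {S} → IsForestWithout E S ⇔ IsForestWithout E* (false ∷ S)
  forest⇔ = mk⇔ (λ acyclic _ C → let m , C′ = contract C in acyclic m C′)
                (λ acyclic _ C → let m , C′ = expand C in acyclic m C′)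

lemma1 : ∀ {n} (E : Edges n) (w : Fin n → ℚ) (k : ℕ) → 1 ≤ k →
    (R : Subset n) → IsForestWithout E R →
    (x y : Fin n) (ex : Fin (length E)) →
    x ∉ R → y ∉ R → Joins (lookup E ex) x y →
    (∀ (j : Fin (length E)) (b : Fin n) → Joins (lookup E j) x b → b ∉ R → j ≡ ex) →
    ¬ (Σ (Fin n × Fin n × Fin n) λ { (r₁ , r₂ , r₃) →
         r₁ ≢ r₂ × r₁ ≢ r₃ × r₂ ≢ r₃ ×
         r₁ ∈ R × r₂ ∈ R × r₃ ∈ R ×
         Adjacent E x r₁ × Adjacent E x r₂ × Adjacent E x r₃ }) →
    (W : ℚ) →
    (Σ (Subset n) λ S →
       (∀ v → v ∈ S → v ∉ R) × ∣ S ∣ ≤ k × wsum w S ≤ℚ W × IsForestWithout E S)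
    ⇔
    (Σ (Subset (suc n)) λ S′ →
       zero ∉ S′ × (∀ v → suc v ∈ S′ → v ∉ R) × ∣ S′ ∣ ≤ k ×
       wsum (wstar w) S′ ≤ℚ W × IsForestWithout (subdivide E ex x y) S′)
lemma1 E w k _ R _ x y ex _ _ xy∈E _ _ W = mk⇔
  (λ { (S , S∩R≡∅ , |S|≤k , wS≤W , acyclic) →
         false ∷ S , (λ ()) , (λ { v (there v∈S) → S∩R≡∅ v v∈S }) , |S|≤k , wS≤W ,
         Equivalence.to forest⇔ acyclic })
  (λ { (true ∷ _ , x*∉S′ , _) → ⊥-elim (x*∉S′ here)
     ; (false ∷ S , _ , S∩R≡∅ , |S|≤k , wS≤W , acyclic) →
         S , (λ v v∈S → S∩R≡∅ v (there v∈S)) , |S|≤k , wS≤W ,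
         Equivalence.from forest⇔ acyclic })
  where open Subdivision E ex xy∈E
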